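{- Let $x,y$ be nonnegative integers and let $\mathcal{G}_{\mathrm P}(x,y)$ be the Sprague–Grundy value of two-pile Nim with a pass, with piles of sizes $x$ and $y$ and the pass still available. Then: (a) $\mathcal{G}_{\mathrm P}(x,y)=0$ if and only if one of the following holds: - $x=y=0$; - $x=2n-1$ and $y=2n$ for some positive integer $n$; - $x=2n$ and $y=2n-1$ for some positive integer $n$. (b) $\mathcal{G}_{\mathrm P}(x,y)=1$ if and only if one of the following holds: - $(x,y)\in\{(0,2),(2,0)\}$; - $x=y$, $x\ne0$ and $x\ne2$. (c) $\mathcal{G}_{\mathrm P}(x,y)=2$ if and only if one of the following holds: - $(x,y)\in\{(0,1),(1,0),(2,2),(3,5),(4,7),(5,3),(6,8),(7,4),(8,6)\}$; - $(x-1)\oplus(y-1)=3$ and $x,y\ge 9$.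
   Context: Games are impartial under normal play: the player with no legal move loses. Two-pile Nim with a pass has positions $(x,y,p)$ with $x,y\in\mathbb{Z}_{\ge0}$ and $p\in\{0,1\}$, where $p=1$ means the pass is still available. The options of $(x,y,p)$ are: - $(x',y,p)$ for each $x'<x$; - $(x,y',p)$ for each $y'<y$; - if $p=1$ and $(x,y)\ne(0,0)$, additionally $(x,y,0)$ (the pass). $\mathcal{G}_{\mathrm P}(x,y)$ is the Sprague–Grundy value of $(x,y,1)$. The Sprague–Grundy value is $\mathcal{G}(g)=\mathrm{mex}\{\mathcal{G}(g'): g' \text{ an option of } g\}$, where $\mathrm{mex}(S)$ is the least nonnegative integer not in $S$. The symbol $\oplus$ denotes bitwise XOR of nonnegative integers. -}

module Defs where

open import Data.Nat using (ℕ; zero; suc; _+_; _*_; _≡ᵇ_; _/_; _%_)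
open import Data.Bool using (Bool; true; false; if_then_else_)
open import Data.List using (List; []; _∷_; _++_; map; upTo; length)
open import Data.Bool.ListAction using (any)

-- Positions (x , y , p) of two-pile Nim with a pass; p = true means the
-- pass is still available.

-- mex of a finite list of naturals: least n not occurring in the list.
-- (searches 0,1,... ; the answer is at most the list length)
_∈ᵇ_ : ℕ → List ℕ → Bool
n ∈ᵇ xs = any (n ≡ᵇ_) xs

mexFrom : ℕ → ℕ → List ℕ → ℕ
mexFrom zero     n xs = n
mexFrom (suc k)  n xs = if n ∈ᵇ xs then mexFrom k (suc n) xs else n

mex : List ℕ → ℕ
mex xs = mexFrom (length xs) 0 xs

-- Sprague–Grundy value, computed by recursion on a fuel parameter.
-- Each move decreases  x + y + (1 if pass available)  by at least one,
-- so fuel  suc (x + y + passBit p)  is always sufficient.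
passBit : Bool → ℕ
passBit true  = 1
passBit false = 0

isZero : ℕ → ℕ → Bool
isZero zero zero = true
isZero _    _    = false

grundyF : ℕ → ℕ → ℕ → Bool → ℕ
grundyF zero     x y p = 0
grundyF (suc k)  x y p = mex (opts p)
  where
    moves : List ℕ
    moves = map (λ x' → grundyF k x' y p) (upTo x)
         ++ map (λ y' → grundyF k x y' p) (upTo y)
    opts : Bool → List ℕ
    opts true  = if isZero x y then moves else grundyF k x y false ∷ moves
    opts false = moves

grundy : ℕ → ℕ → Bool → ℕ
grundy x y p = grundyF (suc (x + y + passBit p)) x y p

GP : ℕ → ℕ → ℕ
GP x y = grundy x y true

xorF : ℕ → ℕ → ℕ → ℕ
xorF zero    a b = 0
xorF (suc k) a b =
  (if (a % 2) ≡ᵇ (b % 2) then 0 else 1) + 2 * xorF k (a / 2) (b / 2)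

_⊕_ : ℕ → ℕ → ℕ
a ⊕ b = xorF (a + b) a b

-- For each u ≤ 2 and each x there is exactly one y with 𝒢_P(x,y) = u, the u-partner of x, and
-- taking u-partners is an involution. This goes by induction on the position: a rook move from
-- (x,y) reaches value u iff partner u x < y or partner u y < x, so the mex at (x,y) is u exactly
-- when y is the u-partner of x, provided that partners of different values differ, that the pass
-- from (x, partner u x) does not have value u, and that whenever y is none of the first u partners
-- of x, value u is reached by a rook move or by the pass. These conditions on the explicit partner
-- functions are eventually periodic (period 4 from 9 on) and are verified by evaluation. The Nim
-- values behind the pass are characterised the same way, with partners x, x ⊕ 1 and x ⊕ 2.

module Submission where

open import Defs

open import Data.Bool using (Bool; true; false; if_then_else_; T)
import Data.Bool.Properties as Bool
open import Data.Empty using (⊥-elim)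
open import Data.Fin.Properties using (pigeonhole; toℕ<n)
open import Data.List using (List; []; _∷_; _++_; map; upTo; length; lookup)
open import Data.List.Membership.Propositional using (_∈_; _∉_; find)
open import Data.List.Membership.Propositional.Properties
  using (∈-upTo⁺; ∈-upTo⁻; ∈-map⁺; ∈-map⁻; ∈-++⁺ˡ; ∈-++⁺ʳ; ∈-++⁻)
open import Data.List.Properties using (map-cong-local)
open import Data.List.Relation.Unary.All using (All)
import Data.List.Relation.Unary.All as All
open import Data.List.Relation.Unary.Any as Any using (Any; here)
open import Data.List.Relation.Unary.Any.Properties using (any⁺; any⁻; lookup-index)
open import Data.Nat using (ℕ; zero; suc; _+_; _*_; _∸_; _≥_; _≤_; _<_; _≡ᵇ_; z≤n; s≤s; _/_; _%_)
open import Data.Nat.DivMod using (m/n<m; m/n≤m; m/n≡1+[m∸n]/n; m≡m%n+[m/n]*n; m%n<n)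
open import Data.Nat.Induction using (<-rec)
open import Data.Nat.Properties
  using (_≟_; _<?_; ≡ᵇ⇒≡; ≡⇒≡ᵇ; ≤-refl; ≤-trans; ≤-pred; <-irrefl; <-trans; <-≤-trans; ≤-<-trans; <-cmp;
         ≮⇒≥; n≤1+n; m≤m+n; m<m+n; m<1+n⇒m≤n; m<1+n⇒m<n∨m≡n; m≤n⇒m<n∨m≡n; m≤n⇒∃[o]m+o≡n;
         +-suc; +-identityʳ; +-monoˡ-<; +-monoʳ-<; +-mono-<-≤; *-suc; *-cancelˡ-≡; suc-injective; even≢odd)
open import Data.Product using (_×_; _,_; ∃-syntax; proj₁; proj₂)
open import Data.Sum using (_⊎_; inj₁; inj₂)
import Data.Sum as Sum
open import Data.Unit using (tt)
open import Function.Base using (_∘_)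
open import Function.Bundles using (_⇔_; mk⇔; Equivalence)
open import Function.Properties.Equivalence using () renaming (trans to ⇔-trans)
open import Relation.Binary using () renaming (Decidable to Decidable₂)
open import Relation.Binary.Definitions using (tri<; tri≈; tri>)
open import Relation.Binary.PropositionalEquality
  using (_≡_; _≢_; refl; sym; trans; cong; cong₂; subst; subst₂; module ≡-Reasoning)
open import Relation.Nullary using (¬_)
open import Relation.Nullary.Decidable
  using (Dec; yes; no; does; True; toWitness; fromWitness; decidable-stable; ¬?; _⊎-dec_)
open import Relation.Unary using (Decidable)

open ≡-Reasoning

-- Minimal excludants

∈ᵇ⇒∈ : ∀ {n xs} → T (n ∈ᵇ xs) → n ∈ xs
∈ᵇ⇒∈ {n} {xs} t = Any.map (≡ᵇ⇒≡ n _) (any⁻ (n ≡ᵇ_) xs t)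

∈⇒∈ᵇ : ∀ {n xs} → n ∈ xs → T (n ∈ᵇ xs)
∈⇒∈ᵇ {n} n∈xs = any⁺ (n ≡ᵇ_) (Any.map (≡⇒≡ᵇ n _) n∈xs)

below⊆⇒≤length : ∀ {n xs} → (∀ {w} → w < n → w ∈ xs) → n ≤ length xs
below⊆⇒≤length {n} {xs} below = ≮⇒≥ λ length<n →
  let i , j , i<j , same = pigeonhole length<n (λ k → Any.index (below (toℕ<n k)))
  in <-irrefl (trans (lookup-index (below (toℕ<n i)))
                (trans (cong (lookup xs) same) (sym (lookup-index (below (toℕ<n j)))))) i<j

IsMex : List ℕ → ℕ → Set
IsMex xs u = u ∉ xs × (∀ {w} → w < u → w ∈ xs)

extend-below : ∀ {n xs} → (∀ {w} → w < n → w ∈ xs) → n ∈ xs → ∀ {w} → w < suc n → w ∈ xs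
extend-below below n∈xs w<1+n with m<1+n⇒m<n∨m≡n w<1+n
... | inj₁ w<n  = below w<n
... | inj₂ refl = n∈xs

mexFrom-isMex : ∀ k n {xs} → length xs ≤ n + k → (∀ {w} → w < n → w ∈ xs) → IsMex xs (mexFrom k n xs)
mexFrom-isMex zero n {xs} length≤n below = n∉xs , below
  where
  n∉xs : n ∉ xs
  n∉xs n∈xs = <-irrefl refl (<-≤-trans (below⊆⇒≤length (extend-below below n∈xs))
                                       (subst (length xs ≤_) (+-identityʳ n) length≤n))
mexFrom-isMex (suc k) n {xs} length≤ below with n ∈ᵇ xs in n∈ᵇxs
... | true  = mexFrom-isMex k (suc n) (subst (length xs ≤_) (+-suc n k) length≤)
                (extend-below below (∈ᵇ⇒∈ (subst T (sym n∈ᵇxs) tt)))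
... | false = (λ n∈xs → subst T n∈ᵇxs (∈⇒∈ᵇ n∈xs)) , below

mex-isMex : ∀ xs → IsMex xs (mex xs)
mex-isMex xs = mexFrom-isMex (length xs) 0 ≤-refl (λ ())

isMex-unique : ∀ {xs u v} → IsMex xs u → IsMex xs v → u ≡ v
isMex-unique {u = u} {v} (u∉ , below-u) (v∉ , below-v) with <-cmp u v
... | tri< u<v _ _ = ⊥-elim (u∉ (below-v u<v))
... | tri≈ _ u≡v _ = u≡v
... | tri> _ _ v<u = ⊥-elim (v∉ (below-u v<u))

mex≡ : ∀ {xs u} → IsMex xs u → mex xs ≡ u
mex≡ {xs} = isMex-unique (mex-isMex xs)

-- Grundy values as solutions of the mex recursion

size : ℕ → ℕ → Bool → ℕ
size x y p = x + y + passBit p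

rookOptions : (ℕ → ℕ → ℕ) → ℕ → ℕ → List ℕ
rookOptions g x y = map (λ x' → g x' y) (upTo x) ++ map (g x) (upTo y)

passOptions : (ℕ → ℕ → ℕ) → Bool → ℕ → ℕ → List ℕ
passOptions g true  x y = if isZero x y then [] else g x y ∷ []
passOptions g false x y = []

options : (ℕ → ℕ → Bool → ℕ) → ℕ → ℕ → Bool → List ℕ
options g x y p = passOptions (λ a b → g a b false) p x y ++ rookOptions (λ a b → g a b p) x y

grundyF-suc : ∀ k x y p → grundyF (suc k) x y p ≡ mex (options (grundyF k) x y p)
grundyF-suc k x y false = refl
grundyF-suc k x y true with isZero x y
... | true  = refl
... | false = refl

upTo-map-cong : ∀ {f g : ℕ → ℕ} n → (∀ {i} → i < n → f i ≡ g i) → map f (upTo n) ≡ map g (upTo n)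
upTo-map-cong n f≡g = map-cong-local (All.tabulate λ i∈ → f≡g (∈-upTo⁻ i∈))

passOptions-cong : ∀ {g h : ℕ → ℕ → ℕ} p x y → (p ≡ true → g x y ≡ h x y) →
                   passOptions g p x y ≡ passOptions h p x y
passOptions-cong true  x y g≡h = cong (λ v → if isZero x y then [] else v ∷ []) (g≡h refl)
passOptions-cong false x y _   = refl

options-cong : ∀ {g h} x y p → (∀ {x' y' p'} → size x' y' p' < size x y p → g x' y' p' ≡ h x' y' p') →
               options g x y p ≡ options h x y p
options-cong x y p g≡h = cong₂ _++_
  (passOptions-cong p x y λ { refl → g≡h (+-monoʳ-< (x + y) (s≤s z≤n)) })
  (cong₂ _++_ (upTo-map-cong x λ x'<x → g≡h (+-monoˡ-< (passBit p) (+-monoˡ-< y x'<x)))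
              (upTo-map-cong y λ y'<y → g≡h (+-monoˡ-< (passBit p) (+-monoʳ-< x y'<y))))

grundyF-fuel : ∀ {k l} x y p → size x y p < k → size x y p < l → grundyF k x y p ≡ grundyF l x y p
grundyF-fuel {suc k} {suc l} x y p s<k s<l = begin
  grundyF (suc k) x y p              ≡⟨ grundyF-suc k x y p ⟩
  mex (options (grundyF k) x y p)    ≡⟨ cong mex (options-cong x y p λ s'<s →
                                          grundyF-fuel _ _ _ (<-≤-trans s'<s (≤-pred s<k))
                                                             (<-≤-trans s'<s (≤-pred s<l))) ⟩
  mex (options (grundyF l) x y p)    ≡⟨ sym (grundyF-suc l x y p) ⟩
  grundyF (suc l) x y p              ∎

grundy-unfold : ∀ x y p → grundy x y p ≡ mex (options grundy x y p)
grundy-unfold x y p = trans (grundyF-suc (size x y p) x y p)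
  (cong mex (options-cong x y p λ s'<s → grundyF-fuel _ _ _ s'<s ≤-refl))

-- Games with rook moves and extra options

module RookGame
  (g : ℕ → ℕ → ℕ) (extra : ℕ → ℕ → List ℕ)
  (g-unfold : ∀ x y → g x y ≡ mex (extra x y ++ rookOptions g x y))
  (K : ℕ) (partner : ℕ → ℕ → ℕ)
  (partner-involutive : ∀ {u} → u < K → ∀ x → partner u (partner u x) ≡ x)
  (partner-distinct : ∀ {v u} → v < u → u < K → ∀ x → partner v x ≢ partner u x)
  (extra-avoids : ∀ {u} → u < K → ∀ x → u ∉ extra x (partner u x))
  (covered : ∀ {u} → u < K → ∀ x y → (∀ {v} → v ≤ u → y ≢ partner v x) →
             partner u x < y ⊎ partner u y < x ⊎ u ∈ extra x y)
  where

  Characterised : ℕ → ℕ → Set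
  Characterised x y = ∀ {u} → u < K → g x y ≡ u ⇔ y ≡ partner u x

  module _ x y (row : ∀ {x'} → x' < x → ∀ y → Characterised x' y)
               (column : ∀ {y'} → y' < y → Characterised x y') where

    rowValues columnValues opts : List ℕ
    rowValues    = map (λ x' → g x' y) (upTo x)
    columnValues = map (g x) (upTo y)
    opts         = extra x y ++ rowValues ++ columnValues

    ∈-opts : ∀ {u} → u < K → partner u x < y ⊎ partner u y < x ⊎ u ∈ extra x y → u ∈ opts
    ∈-opts u<K (inj₁ r<y) = ∈-++⁺ʳ (extra x y) (∈-++⁺ʳ rowValues
      (subst (_∈ columnValues) (Equivalence.from (column r<y u<K) refl) (∈-map⁺ (g x) (∈-upTo⁺ r<y))))
    ∈-opts u<K (inj₂ (inj₁ r<x)) = ∈-++⁺ʳ (extra x y) (∈-++⁺ˡ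
      (subst (_∈ rowValues) (Equivalence.from (row r<x y u<K) (sym (partner-involutive u<K y)))
             (∈-map⁺ (λ x' → g x' y) (∈-upTo⁺ r<x))))
    ∈-opts u<K (inj₂ (inj₂ u∈extra)) = ∈-++⁺ˡ u∈extra

    ∉-opts : ∀ {u} → u < K → y ≡ partner u x → u ∉ opts
    ∉-opts {u} u<K refl u∈opts with ∈-++⁻ (extra x y) u∈opts
    ... | inj₁ u∈extra = extra-avoids u<K x u∈extra
    ... | inj₂ u∈rook with ∈-++⁻ rowValues u∈rook
    ...   | inj₁ u∈row with x' , x'∈ , u≡ ← ∈-map⁻ (λ x′ → g x′ y) u∈row =
            <-irrefl x'≡x (∈-upTo⁻ x'∈)
      where
      x'≡x : x' ≡ x
      x'≡x = begin
        x'                        ≡⟨ sym (partner-involutive u<K x') ⟩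
        partner u (partner u x')  ≡⟨ cong (partner u) (sym (Equivalence.to (row (∈-upTo⁻ x'∈) y u<K) (sym u≡))) ⟩
        partner u (partner u x)   ≡⟨ partner-involutive u<K x ⟩
        x                         ∎
    ...   | inj₂ u∈column with y' , y'∈ , u≡ ← ∈-map⁻ (g x) u∈column =
            <-irrefl (Equivalence.to (column (∈-upTo⁻ y'∈) u<K) (sym u≡)) (∈-upTo⁻ y'∈)

    isMex-partner : ∀ {u} → u < K → y ≡ partner u x → IsMex opts u
    isMex-partner u<K y≡ = ∉-opts u<K y≡ , λ w<u →
      ∈-opts (<-trans w<u u<K) (covered (<-trans w<u u<K) x y λ v≤w y≡′ →
        partner-distinct (≤-<-trans v≤w w<u) u<K x (trans (sym y≡′) y≡))

    partner-isMex : ∀ {u} → u < K → IsMex opts u → y ≡ partner u x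
    partner-isMex {u} u<K mex-u = decidable-stable (y ≟ partner u x) λ y≢ →
      proj₁ mex-u (∈-opts u<K (covered u<K x y (avoids y≢)))
      where
      avoids : y ≢ partner u x → ∀ {v} → v ≤ u → y ≢ partner v x
      avoids y≢ v≤u y≡ with m≤n⇒m<n∨m≡n v≤u
      ... | inj₁ v<u  = <-irrefl (isMex-unique (isMex-partner (<-trans v<u u<K) y≡) mex-u) v<u
      ... | inj₂ refl = y≢ y≡

    characterised : Characterised x y
    characterised u<K = mk⇔
      (λ g≡u → partner-isMex u<K (subst (IsMex opts) (trans (sym (g-unfold x y)) g≡u) (mex-isMex opts)))
      (λ y≡ → trans (g-unfold x y) (mex≡ (isMex-partner u<K y≡)))

  g≡⇔partner : ∀ x y → Characterised x y
  g≡⇔partner = <-rec _ λ x row → <-rec _ λ y column → characterised x y row column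

-- Eventually periodic facts, checked by evaluation

unshift-< : ∀ t d a → t + a < t + suc d + a
unshift-< t d a = +-monoˡ-< a (m<m+n t (s≤s z≤n))

eventually-periodic : ∀ {P : ℕ → Set} t d → (∀ {x} → x < t + suc d → P x) →
                      (∀ a → P (t + a) → P (t + suc d + a)) → ∀ x → P x
eventually-periodic {P} t d base step = <-rec P go
  where
  go : ∀ x → (∀ {x'} → x' < x → P x') → P x
  go x rec with x <? t + suc d
  ... | yes x< = base x<
  ... | no x≮  = let a , x≡ = m≤n⇒∃[o]m+o≡n (≮⇒≥ x≮) in
                 subst P x≡ (step a (rec (subst (t + a <_) x≡ (unshift-< t d a))))

eventually-periodic₂ : ∀ {P : ℕ → ℕ → Set} t d → (∀ {x y} → x < t + suc d ⊎ y < t + suc d → P x y) →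
                       (∀ a b → P (t + a) (t + b) → P (t + suc d + a) (t + suc d + b)) → ∀ x y → P x y
eventually-periodic₂ {P} t d base step = <-rec (λ x → ∀ y → P x y) go
  where
  go : ∀ x → (∀ {x'} → x' < x → ∀ y → P x' y) → ∀ y → P x y
  go x rec y with x <? t + suc d | y <? t + suc d
  ... | yes x< | _      = base (inj₁ x<)
  ... | no _   | yes y< = base (inj₂ y<)
  ... | no x≮  | no y≮  = let a , x≡ = m≤n⇒∃[o]m+o≡n (≮⇒≥ x≮)
                              b , y≡ = m≤n⇒∃[o]m+o≡n (≮⇒≥ y≮) in
                          subst₂ P x≡ y≡ (step a b (rec (subst (t + a <_) x≡ (unshift-< t d a)) (t + b)))

equal-does⇒ : ∀ {A B : Set} (a? : Dec A) (b? : Dec B) → does a? ≡ does b? → A → B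
equal-does⇒ (yes _) (yes b) _  _ = b
equal-does⇒ (no ¬a) _       _  a = ⊥-elim (¬a a)
equal-does⇒ (yes _) (no _)  () _

DecidedBelow : ∀ {P : ℕ → Set} → Decidable P → ℕ → Set
DecidedBelow P? n = True (All.all? P? (upTo n))

decided-below : ∀ {P : ℕ → Set} (P? : Decidable P) n → DecidedBelow P? n → ∀ {x} → x < n → P x
decided-below P? n ok x<n = All.lookup (toWitness {a? = All.all? P? (upTo n)} ok) (∈-upTo⁺ x<n)

-- The shift hypotheses are meant to hold by refl: when every function inside P? peels off
-- suc's, shifting all arguments beyond t by suc d adds the same suc's to both sides of every
-- comparison, so both decisions evaluate to the same Boolean.
decide-periodic : ∀ {P : ℕ → Set} (P? : Decidable P) t d → DecidedBelow P? (t + suc d) →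
                  (∀ a → does (P? (t + a)) ≡ does (P? (t + suc d + a))) → ∀ x → P x
decide-periodic P? t d base shift = eventually-periodic t d (decided-below P? _ base) λ a →
  equal-does⇒ (P? (t + a)) (P? (t + suc d + a)) (shift a)

decided-strip : ∀ {P : ℕ → ℕ → Set} (P? : Decidable₂ P) m w →
                DecidedBelow (λ x → All.all? (P? x) (upTo w)) m →
                (∀ b → DecidedBelow (λ x → P? x (w + b)) m) →
                ∀ {x} y → x < m → P x y
decided-strip {P} P? m w table tail y x<m with y <? w
... | yes y<w = decided-below (P? _) w (fromWitness (decided-below _ m table x<m)) y<w
... | no y≮w  = let b , eq = m≤n⇒∃[o]m+o≡n (≮⇒≥ y≮w) in
                subst (P _) eq (decided-below (λ x → P? x (w + b)) m (tail b) x<m)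

decide-periodic₂ : ∀ {P : ℕ → ℕ → Set} (P? : Decidable₂ P) t d w →
  DecidedBelow (λ x → All.all? (P? x) (upTo w)) (t + suc d) →
  (∀ b → DecidedBelow (λ x → P? x (w + b)) (t + suc d)) →
  DecidedBelow (λ y → All.all? (λ x → P? x y) (upTo w)) (t + suc d) →
  (∀ a → DecidedBelow (λ y → P? (w + a) y) (t + suc d)) →
  (∀ a b → does (P? (t + a) (t + b)) ≡ does (P? (t + suc d + a) (t + suc d + b))) →
  ∀ x y → P x y
decide-periodic₂ {P} P? t d w rows rowTails columns columnTails shift =
  eventually-periodic₂ t d base λ a b →
    equal-does⇒ (P? (t + a) (t + b)) (P? (t + suc d + a) (t + suc d + b)) (shift a b)
  where
  base : ∀ {x y} → x < t + suc d ⊎ y < t + suc d → P x y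
  base {y = y} (inj₁ x<) = decided-strip P? _ w rows rowTails y x<
  base {x}     (inj₂ y<) = decided-strip {P = λ y x → P x y} (λ y x → P? x y) _ w columns columnTails x y<

-- Bitwise xor

half-sum-≤ : ∀ a b {k} → a + b ≤ suc k → a / 2 + b / 2 ≤ k
half-sum-≤ zero    zero    _  = z≤n
half-sum-≤ zero    (suc b) ≤k = ≤-pred (≤-trans (m/n<m (suc b) 2 (s≤s (s≤s z≤n))) ≤k)
half-sum-≤ (suc a) b       ≤k = ≤-pred (≤-trans (+-mono-<-≤ (m/n<m (suc a) 2 (s≤s (s≤s z≤n))) (m/n≤m b 2)) ≤k)

bitXor : ℕ → ℕ → ℕ
bitXor i j = if i ≡ᵇ j then 0 else 1

xorF-fuel : ∀ {k l} a b → a + b ≤ k → a + b ≤ l → xorF k a b ≡ xorF l a b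
xorF-fuel {zero}  {zero}  _    _    _  _  = refl
xorF-fuel {zero}  {suc l} zero zero _  _  = cong (2 *_) (xorF-fuel {0} {l} 0 0 z≤n z≤n)
xorF-fuel {suc k} {zero}  zero zero _  _  = cong (2 *_) (xorF-fuel {k} {0} 0 0 z≤n z≤n)
xorF-fuel {suc k} {suc l} a    b    ≤k ≤l = cong (λ r → bitXor (a % 2) (b % 2) + 2 * r)
  (xorF-fuel (a / 2) (b / 2) (half-sum-≤ a b ≤k) (half-sum-≤ a b ≤l))

⊕-step : ∀ a b → a ⊕ b ≡ bitXor (a % 2) (b % 2) + 2 * ((a / 2) ⊕ (b / 2))
⊕-step a b = begin
  a ⊕ b                                         ≡⟨ xorF-fuel a b ≤-refl (n≤1+n _) ⟩
  xorF (suc (a + b)) a b                        ≡⟨ cong (λ r → bitXor (a % 2) (b % 2) + 2 * r)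
                                                     (xorF-fuel (a / 2) (b / 2) (half-sum-≤ a b (n≤1+n _)) ≤-refl) ⟩
  bitXor (a % 2) (b % 2) + 2 * ((a / 2) ⊕ (b / 2))  ∎

bitXor-self : ∀ i → bitXor i i ≡ 0
bitXor-self i with i ≡ᵇ i | ≡⇒≡ᵇ i i refl
... | true | _ = refl

bitXor-≢ : ∀ {i j} → i ≢ j → bitXor i j ≡ 1
bitXor-≢ {i} {j} i≢j with i ≡ᵇ j in eq
... | true  = ⊥-elim (i≢j (≡ᵇ⇒≡ i j (subst T (sym eq) tt)))
... | false = refl

bitXor≤1 : ∀ i j → bitXor i j ≤ 1
bitXor≤1 i j with i ≡ᵇ j
... | true  = z≤n
... | false = ≤-refl

bitXor-cancelˡ : ∀ {i j k} → i < 2 → j < 2 → k < 2 → bitXor i j ≡ bitXor i k → j ≡ k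
bitXor-cancelˡ {j = 0} {0} _ _ _ _ = refl
bitXor-cancelˡ {j = 1} {1} _ _ _ _ = refl
bitXor-cancelˡ {0} {0} {1} _ _ _ ()
bitXor-cancelˡ {0} {1} {0} _ _ _ ()
bitXor-cancelˡ {1} {0} {1} _ _ _ ()
bitXor-cancelˡ {1} {1} {0} _ _ _ ()
bitXor-cancelˡ {suc (suc _)} (s≤s (s≤s ())) _ _ _
bitXor-cancelˡ {j = suc (suc _)} _ (s≤s (s≤s ())) _ _
bitXor-cancelˡ {k = suc (suc _)} _ _ (s≤s (s≤s ())) _

parity-split : ∀ {i j m n} → i ≤ 1 → j ≤ 1 → i + 2 * m ≡ j + 2 * n → i ≡ j × m ≡ n
parity-split {0} {0} {m} {n} _ _ eq = refl , *-cancelˡ-≡ m n 2 eq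
parity-split {1} {1} {m} {n} _ _ eq = refl , *-cancelˡ-≡ m n 2 (suc-injective eq)
parity-split {0} {1} {m} {n} _ _ eq = ⊥-elim (even≢odd m n eq)
parity-split {1} {0} {m} {n} _ _ eq = ⊥-elim (even≢odd n m (sym eq))
parity-split {suc (suc _)} (s≤s ()) _ _
parity-split {j = suc (suc _)} _ (s≤s ()) _

⊕-self : ∀ a → a ⊕ a ≡ 0
⊕-self a = xorF-self (a + a) a
  where
  xorF-self : ∀ k a → xorF k a a ≡ 0
  xorF-self zero    a = refl
  xorF-self (suc k) a = cong₂ (λ i r → i + 2 * r) (bitXor-self (a % 2)) (xorF-self k (a / 2))

⊕-cancelˡ : ∀ a {b c} → a ⊕ b ≡ a ⊕ c → b ≡ c
⊕-cancelˡ a {b} {c} = go (b + c) {a} ≤-refl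
  where
  go : ∀ k {a b c} → b + c ≤ k → a ⊕ b ≡ a ⊕ c → b ≡ c
  go zero {b = zero} {zero} _ _ = refl
  go (suc k) {a} {b} {c} b+c≤ eq = begin
    b                  ≡⟨ m≡m%n+[m/n]*n b 2 ⟩
    b % 2 + b / 2 * 2  ≡⟨ cong₂ (λ i h → i + h * 2)
                            (bitXor-cancelˡ (m%n<n a 2) (m%n<n b 2) (m%n<n c 2) (proj₁ bits×halves))
                            (go k {a / 2} (half-sum-≤ b c b+c≤) (proj₂ bits×halves)) ⟩
    c % 2 + c / 2 * 2  ≡⟨ sym (m≡m%n+[m/n]*n c 2) ⟩
    c                  ∎
    where
    bits×halves : bitXor (a % 2) (b % 2) ≡ bitXor (a % 2) (c % 2) × (a / 2) ⊕ (b / 2) ≡ (a / 2) ⊕ (c / 2)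
    bits×halves = parity-split (bitXor≤1 (a % 2) (b % 2)) (bitXor≤1 (a % 2) (c % 2))
                               (trans (sym (⊕-step a b)) (trans eq (⊕-step a c)))

LowBitsFlipped : ℕ → ℕ → Set
LowBitsFlipped a b = a % 2 ≢ b % 2 × (a / 2) % 2 ≢ (b / 2) % 2 × a / 2 / 2 ≡ b / 2 / 2

lowBitsFlipped⇒⊕≡3 : ∀ {a b} → LowBitsFlipped a b → a ⊕ b ≡ 3
lowBitsFlipped⇒⊕≡3 {a} {b} (bit₀ , bit₁ , high) = begin
  a ⊕ b
    ≡⟨ ⊕-step a b ⟩
  bitXor (a % 2) (b % 2) + 2 * ((a / 2) ⊕ (b / 2))
    ≡⟨ cong₂ (λ i r → i + 2 * r) (bitXor-≢ bit₀) (⊕-step (a / 2) (b / 2)) ⟩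
  1 + 2 * (bitXor (a / 2 % 2) (b / 2 % 2) + 2 * ((a / 2 / 2) ⊕ (b / 2 / 2)))
    ≡⟨ cong₂ (λ i r → 1 + 2 * (i + 2 * r)) (bitXor-≢ bit₁)
             (trans (cong ((a / 2 / 2) ⊕_) (sym high)) (⊕-self (a / 2 / 2))) ⟩
  3 ∎

half-+4 : ∀ n → (4 + n) / 2 ≡ 2 + n / 2
half-+4 n = trans (half-+2 (2 + n)) (cong suc (half-+2 n))
  where
  half-+2 : ∀ n → (2 + n) / 2 ≡ 1 + n / 2
  half-+2 n = m/n≡1+[m∸n]/n {2 + n} {2} (s≤s (s≤s z≤n))

quarter-+4 : ∀ n → (4 + n) / 2 / 2 ≡ 1 + n / 2 / 2
quarter-+4 n = trans (cong (_/ 2) (half-+4 n)) (m/n≡1+[m∸n]/n {2 + n / 2} {2} (s≤s (s≤s z≤n)))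

lowBitsFlipped-+4 : ∀ {a b} → LowBitsFlipped a b → LowBitsFlipped (4 + a) (4 + b)
lowBitsFlipped-+4 {a} {b} (bit₀ , bit₁ , high) =
  bit₀ ,
  (λ eq → bit₁ (subst₂ (λ m n → m % 2 ≡ n % 2) (half-+4 a) (half-+4 b) eq)) ,
  trans (quarter-+4 a) (trans (cong suc high) (sym (quarter-+4 b)))

-- x ⊕ 1, x ⊕ 2 and x ⊕ 3 by structural recursion, so that they evaluate on open terms like 13 + a.
xor1 : ℕ → ℕ
xor1 0 = 1
xor1 1 = 0
xor1 (suc (suc n)) = 2 + xor1 n

xor2 : ℕ → ℕ
xor2 0 = 2
xor2 1 = 3
xor2 2 = 0
xor2 3 = 1
xor2 (suc (suc (suc (suc n)))) = 4 + xor2 n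

xor3 : ℕ → ℕ
xor3 0 = 3
xor3 1 = 2
xor3 2 = 1
xor3 3 = 0
xor3 (suc (suc (suc (suc n)))) = 4 + xor3 n

pass₀ : ℕ → ℕ
pass₀ 0 = 0
pass₀ (suc n) = suc (xor1 n)

pass₁ : ℕ → ℕ
pass₁ 0 = 2
pass₁ 1 = 1
pass₁ 2 = 0
pass₁ n@(suc (suc (suc _))) = n

pass₂ : ℕ → ℕ
pass₂ 0 = 1
pass₂ 1 = 0
pass₂ 2 = 2
pass₂ 3 = 5
pass₂ 4 = 7
pass₂ 5 = 3
pass₂ 6 = 8
pass₂ 7 = 4
pass₂ 8 = 6
pass₂ (suc (suc (suc (suc (suc (suc (suc (suc (suc n))))))))) = 9 + xor3 n

-- Only u < 3 is ever used; larger u repeat the last partner.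
nimPartner passPartner : ℕ → ℕ → ℕ
nimPartner 0 = λ x → x
nimPartner 1 = xor1
nimPartner (suc (suc _)) = xor2
passPartner 0 = pass₀
passPartner 1 = pass₁
passPartner (suc (suc _)) = pass₂

xor1-involutive : ∀ n → xor1 (xor1 n) ≡ n
xor1-involutive 0 = refl
xor1-involutive 1 = refl
xor1-involutive (suc (suc n)) = cong (2 +_) (xor1-involutive n)

xor2-involutive : ∀ n → xor2 (xor2 n) ≡ n
xor2-involutive 0 = refl
xor2-involutive 1 = refl
xor2-involutive 2 = refl
xor2-involutive 3 = refl
xor2-involutive (suc (suc (suc (suc n)))) = cong (4 +_) (xor2-involutive n)

xor3-involutive : ∀ n → xor3 (xor3 n) ≡ n
xor3-involutive 0 = refl
xor3-involutive 1 = refl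
xor3-involutive 2 = refl
xor3-involutive 3 = refl
xor3-involutive (suc (suc (suc (suc n)))) = cong (4 +_) (xor3-involutive n)

nimPartner-involutive : ∀ u x → nimPartner u (nimPartner u x) ≡ x
nimPartner-involutive 0 x = refl
nimPartner-involutive 1 x = xor1-involutive x
nimPartner-involutive (suc (suc _)) x = xor2-involutive x

passPartner-involutive : ∀ u x → passPartner u (passPartner u x) ≡ x
passPartner-involutive 0 0 = refl
passPartner-involutive 0 (suc x) = cong suc (xor1-involutive x)
passPartner-involutive 1 0 = refl
passPartner-involutive 1 1 = refl
passPartner-involutive 1 2 = refl
passPartner-involutive 1 (suc (suc (suc _))) = refl
passPartner-involutive (suc (suc _)) x = pass₂-involutive x
  where
  pass₂-involutive : ∀ x → pass₂ (pass₂ x) ≡ x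
  pass₂-involutive 0 = refl
  pass₂-involutive 1 = refl
  pass₂-involutive 2 = refl
  pass₂-involutive 3 = refl
  pass₂-involutive 4 = refl
  pass₂-involutive 5 = refl
  pass₂-involutive 6 = refl
  pass₂-involutive 7 = refl
  pass₂-involutive 8 = refl
  pass₂-involutive (suc (suc (suc (suc (suc (suc (suc (suc (suc n))))))))) = cong (9 +_) (xor3-involutive n)

DistinctPartners : (ℕ → ℕ → ℕ) → ℕ → ℕ → Set
DistinctPartners r K x = All (λ u → All (λ v → r v x ≢ r u x) (upTo u)) (upTo K)

distinctPartners? : ∀ r K → Decidable (DistinctPartners r K)
distinctPartners? r K x = All.all? (λ u → All.all? (λ v → ¬? (r v x ≟ r u x)) (upTo u)) (upTo K)

RookCovered : (ℕ → ℕ → ℕ) → ℕ → ℕ → ℕ → Set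
RookCovered r u x y = Any (λ v → y ≡ r v x) (upTo (suc u)) ⊎ r u x < y ⊎ r u y < x

rookCovered? : ∀ r u → Decidable₂ (RookCovered r u)
rookCovered? r u x y = Any.any? (λ v → y ≟ r v x) (upTo (suc u)) ⊎-dec r u x <? y ⊎-dec r u y <? x

lookup-below : ∀ {P : ℕ → Set} {n} → All P (upTo n) → ∀ {u} → u < n → P u
lookup-below ps u<n = All.lookup ps (∈-upTo⁺ u<n)

rookCovered⇒ : ∀ {r u x y} → RookCovered r u x y → (∀ {v} → v ≤ u → y ≢ r v x) → r u x < y ⊎ r u y < x
rookCovered⇒ (inj₁ y∈) avoid with v , v∈ , y≡ ← find y∈ =
  ⊥-elim (avoid (m<1+n⇒m≤n (∈-upTo⁻ v∈)) y≡)
rookCovered⇒ (inj₂ reached) _ = reached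

nimPartners-distinct : ∀ x → DistinctPartners nimPartner 3 x
nimPartners-distinct = decide-periodic (distinctPartners? nimPartner 3) 0 3 _ λ _ → refl

nimPartners-covered : ∀ x y → All (λ u → RookCovered nimPartner u x y) (upTo 3)
nimPartners-covered =
  decide-periodic₂ (λ x y → All.all? (λ u → rookCovered? nimPartner u x y) (upTo 3)) 0 3 8
    _ (λ _ → _) _ (λ _ → _) λ _ _ → refl

passPartners-distinct : ∀ x → DistinctPartners passPartner 3 x
passPartners-distinct = decide-periodic (distinctPartners? passPartner 3) 9 3 _ λ _ → refl

passPartners-avoid-nim : ∀ x →
  All (λ u → isZero x (passPartner u x) ≡ true ⊎ passPartner u x ≢ nimPartner u x) (upTo 3)
passPartners-avoid-nim =
  decide-periodic (λ x → All.all? (λ u → isZero x (passPartner u x) Bool.≟ true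
                                          ⊎-dec ¬? (passPartner u x ≟ nimPartner u x)) (upTo 3)) 9 3
    _ λ _ → refl

passPartners-covered : ∀ x y → All (λ u → RookCovered passPartner u x y ⊎ y ≡ nimPartner u x) (upTo 3)
passPartners-covered =
  decide-periodic₂ (λ x y → All.all? (λ u → rookCovered? passPartner u x y ⊎-dec y ≟ nimPartner u x) (upTo 3))
    9 3 16 _ (λ _ → _) _ (λ _ → _) λ _ _ → refl

-- Nim and Nim with a pass

nim : ℕ → ℕ → ℕ
nim x y = grundy x y false

module Nim = RookGame nim (λ _ _ → []) (λ x y → grundy-unfold x y false) 3 nimPartner
  (λ {u} _ → nimPartner-involutive u)
  (λ v<u u<3 x → lookup-below (lookup-below (nimPartners-distinct x) u<3) v<u)
  (λ _ _ ())
  (λ u<3 x y avoid → Sum.map₂ inj₁ (rookCovered⇒ (lookup-below (nimPartners-covered x y) u<3) avoid))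

isZero⇒pass₀ : ∀ x y → isZero x y ≡ true → y ≡ pass₀ x
isZero⇒pass₀ zero zero _ = refl

passExtra-avoids : ∀ {u} → u < 3 → ∀ x → u ∉ passOptions nim true x (passPartner u x)
passExtra-avoids {u} u<3 x u∈ with isZero x (passPartner u x) | lookup-below (passPartners-avoid-nim x) u<3
passExtra-avoids u<3 x () | true | _
passExtra-avoids u<3 x (here u≡) | false | inj₁ ()
passExtra-avoids u<3 x (here u≡) | false | inj₂ r≢ = r≢ (Equivalence.to (Nim.g≡⇔partner x _ u<3) (sym u≡))

passExtra-covers : ∀ {u} → u < 3 → ∀ x y → (∀ {v} → v ≤ u → y ≢ passPartner v x) →
                passPartner u x < y ⊎ passPartner u y < x ⊎ u ∈ passOptions nim true x y
passExtra-covers u<3 x y avoid with lookup-below (passPartners-covered x y) u<3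
... | inj₁ rook = Sum.map₂ inj₁ (rookCovered⇒ rook avoid)
... | inj₂ y≡ with isZero x y in zero?
...   | true  = ⊥-elim (avoid z≤n (isZero⇒pass₀ x y zero?))
...   | false = inj₂ (inj₂ (here (sym (Equivalence.from (Nim.g≡⇔partner x y u<3) y≡))))

module Pass = RookGame GP (passOptions nim true) (λ x y → grundy-unfold x y true) 3 passPartner
  (λ {u} _ → passPartner-involutive u)
  (λ v<u u<3 x → lookup-below (lookup-below (passPartners-distinct x) u<3) v<u)
  passExtra-avoids passExtra-covers

-- The partners in closed form

even-or-odd : ∀ n → (∃[ m ] n ≡ 2 * m) ⊎ (∃[ m ] n ≡ suc (2 * m))
even-or-odd zero = inj₁ (0 , refl)
even-or-odd (suc n) with even-or-odd n
... | inj₁ (m , refl) = inj₂ (m , refl)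
... | inj₂ (m , refl) = inj₁ (suc m , sym (*-suc 2 m))

xor1-even : ∀ m → xor1 (2 * m) ≡ suc (2 * m)
xor1-even zero = refl
xor1-even (suc m) = trans (cong xor1 (*-suc 2 m)) (trans (cong (2 +_) (xor1-even m)) (cong suc (sym (*-suc 2 m))))

xor1-odd : ∀ m → xor1 (suc (2 * m)) ≡ 2 * m
xor1-odd zero = refl
xor1-odd (suc m) = trans (cong (xor1 ∘ suc) (*-suc 2 m)) (trans (cong (2 +_) (xor1-odd m)) (sym (*-suc 2 m)))

2*suc∸1 : ∀ m → 2 * suc m ∸ 1 ≡ suc (2 * m)
2*suc∸1 m = cong (_∸ 1) (*-suc 2 m)

ClosedForm₀ ClosedForm₁ ClosedForm₂ : ℕ → ℕ → Set
ClosedForm₀ x y =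
  (x ≡ 0 × y ≡ 0)
  ⊎ (∃[ n ] (n ≥ 1 × x ≡ 2 * n ∸ 1 × y ≡ 2 * n))
  ⊎ (∃[ n ] (n ≥ 1 × x ≡ 2 * n × y ≡ 2 * n ∸ 1))
ClosedForm₁ x y =
  (x ≡ 0 × y ≡ 2) ⊎ (x ≡ 2 × y ≡ 0)
  ⊎ (x ≡ y × ¬ (x ≡ 0) × ¬ (x ≡ 2))
ClosedForm₂ x y =
  (x ≡ 0 × y ≡ 1) ⊎ (x ≡ 1 × y ≡ 0) ⊎ (x ≡ 2 × y ≡ 2)
  ⊎ (x ≡ 3 × y ≡ 5) ⊎ (x ≡ 4 × y ≡ 7) ⊎ (x ≡ 5 × y ≡ 3)
  ⊎ (x ≡ 6 × y ≡ 8) ⊎ (x ≡ 7 × y ≡ 4) ⊎ (x ≡ 8 × y ≡ 6)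
  ⊎ ((x ∸ 1) ⊕ (y ∸ 1) ≡ 3 × x ≥ 9 × y ≥ 9)

pass₀-spec : ∀ x y → y ≡ pass₀ x ⇔ ClosedForm₀ x y
pass₀-spec x y = mk⇔ to from
  where
  to : ∀ {x y} → y ≡ pass₀ x → ClosedForm₀ x y
  to {zero} y≡ = inj₁ (refl , y≡)
  to {suc z} y≡ with even-or-odd z
  ... | inj₁ (m , refl) = inj₂ (inj₁ (suc m , s≤s z≤n , sym (2*suc∸1 m) ,
                            trans y≡ (trans (cong suc (xor1-even m)) (sym (*-suc 2 m)))))
  ... | inj₂ (m , refl) = inj₂ (inj₂ (suc m , s≤s z≤n , sym (*-suc 2 m) ,
                            trans y≡ (trans (cong suc (xor1-odd m)) (sym (2*suc∸1 m)))))

  from : ∀ {x y} → ClosedForm₀ x y → y ≡ pass₀ x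
  from (inj₁ (refl , refl)) = refl
  from (inj₂ (inj₁ (suc m , _ , refl , refl))) = begin
    2 * suc m                 ≡⟨ *-suc 2 m ⟩
    suc (suc (2 * m))         ≡⟨ cong suc (sym (xor1-even m)) ⟩
    pass₀ (suc (2 * m))       ≡⟨ cong pass₀ (sym (2*suc∸1 m)) ⟩
    pass₀ (2 * suc m ∸ 1)     ∎
  from (inj₂ (inj₂ (suc m , _ , refl , refl))) = begin
    2 * suc m ∸ 1             ≡⟨ 2*suc∸1 m ⟩
    suc (2 * m)               ≡⟨ cong suc (sym (xor1-odd m)) ⟩
    pass₀ (suc (suc (2 * m))) ≡⟨ cong pass₀ (sym (*-suc 2 m)) ⟩
    pass₀ (2 * suc m)         ∎

pass₁-spec : ∀ x y → y ≡ pass₁ x ⇔ ClosedForm₁ x y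
pass₁-spec x y = mk⇔ to from
  where
  to : ∀ {x y} → y ≡ pass₁ x → ClosedForm₁ x y
  to {0} y≡ = inj₁ (refl , y≡)
  to {1} y≡ = inj₂ (inj₂ (sym y≡ , (λ ()) , (λ ())))
  to {2} y≡ = inj₂ (inj₁ (refl , y≡))
  to {suc (suc (suc _))} y≡ = inj₂ (inj₂ (sym y≡ , (λ ()) , (λ ())))

  fixed : ∀ x → x ≢ 0 → x ≢ 2 → x ≡ pass₁ x
  fixed 0 x≢0 _ = ⊥-elim (x≢0 refl)
  fixed 1 _ _ = refl
  fixed 2 _ x≢2 = ⊥-elim (x≢2 refl)
  fixed (suc (suc (suc _))) _ _ = refl

  from : ∀ {x y} → ClosedForm₁ x y → y ≡ pass₁ x
  from (inj₁ (refl , refl)) = refl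
  from (inj₂ (inj₁ (refl , refl))) = refl
  from (inj₂ (inj₂ (refl , x≢0 , x≢2))) = fixed _ x≢0 x≢2

xor3-flips : ∀ a → LowBitsFlipped a (xor3 a)
xor3-flips 0 = (λ ()) , (λ ()) , refl
xor3-flips 1 = (λ ()) , (λ ()) , refl
xor3-flips 2 = (λ ()) , (λ ()) , refl
xor3-flips 3 = (λ ()) , (λ ()) , refl
xor3-flips (suc (suc (suc (suc a)))) = lowBitsFlipped-+4 {a} {xor3 a} (xor3-flips a)

⊕-xor3 : ∀ a → a ⊕ xor3 a ≡ 3
⊕-xor3 a = lowBitsFlipped⇒⊕≡3 {a} {xor3 a} (xor3-flips a)

pass₂-large : ∀ a y → y ≥ 9 → (8 + a) ⊕ (y ∸ 1) ≡ 3 → y ≡ 9 + xor3 a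
pass₂-large a (suc y) _ ⊕≡3 = cong suc (⊕-cancelˡ (8 + a) (trans ⊕≡3 (sym (⊕-xor3 (8 + a)))))

pass₂-spec : ∀ x y → y ≡ pass₂ x ⇔ ClosedForm₂ x y
pass₂-spec x y = mk⇔ to from
  where
  to : ∀ {x y} → y ≡ pass₂ x → ClosedForm₂ x y
  to {0} y≡ = inj₁ (refl , y≡)
  to {1} y≡ = inj₂ (inj₁ (refl , y≡))
  to {2} y≡ = inj₂ (inj₂ (inj₁ (refl , y≡)))
  to {3} y≡ = inj₂ (inj₂ (inj₂ (inj₁ (refl , y≡))))
  to {4} y≡ = inj₂ (inj₂ (inj₂ (inj₂ (inj₁ (refl , y≡)))))
  to {5} y≡ = inj₂ (inj₂ (inj₂ (inj₂ (inj₂ (inj₁ (refl , y≡))))))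
  to {6} y≡ = inj₂ (inj₂ (inj₂ (inj₂ (inj₂ (inj₂ (inj₁ (refl , y≡)))))))
  to {7} y≡ = inj₂ (inj₂ (inj₂ (inj₂ (inj₂ (inj₂ (inj₂ (inj₁ (refl , y≡))))))))
  to {8} y≡ = inj₂ (inj₂ (inj₂ (inj₂ (inj₂ (inj₂ (inj₂ (inj₂ (inj₁ (refl , y≡)))))))))
  to {suc (suc (suc (suc (suc (suc (suc (suc (suc a))))))))} refl =
    inj₂ (inj₂ (inj₂ (inj₂ (inj₂ (inj₂ (inj₂ (inj₂ (inj₂
      (⊕-xor3 (8 + a) , m≤m+n 9 a , m≤m+n 9 (xor3 a))))))))))

  from : ∀ {x y} → ClosedForm₂ x y → y ≡ pass₂ x
  from (inj₁ (refl , refl)) = refl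
  from (inj₂ (inj₁ (refl , refl))) = refl
  from (inj₂ (inj₂ (inj₁ (refl , refl)))) = refl
  from (inj₂ (inj₂ (inj₂ (inj₁ (refl , refl))))) = refl
  from (inj₂ (inj₂ (inj₂ (inj₂ (inj₁ (refl , refl)))))) = refl
  from (inj₂ (inj₂ (inj₂ (inj₂ (inj₂ (inj₁ (refl , refl))))))) = refl
  from (inj₂ (inj₂ (inj₂ (inj₂ (inj₂ (inj₂ (inj₁ (refl , refl)))))))) = refl
  from (inj₂ (inj₂ (inj₂ (inj₂ (inj₂ (inj₂ (inj₂ (inj₁ (refl , refl))))))))) = refl
  from (inj₂ (inj₂ (inj₂ (inj₂ (inj₂ (inj₂ (inj₂ (inj₂ (inj₁ (refl , refl)))))))))) = refl
  from {y = y} (inj₂ (inj₂ (inj₂ (inj₂ (inj₂ (inj₂ (inj₂ (inj₂ (inj₂ (⊕≡3 , x≥9 , y≥9))))))))))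
    with a , refl ← m≤n⇒∃[o]m+o≡n x≥9 = pass₂-large a y y≥9 ⊕≡3

lemma4 : (x y : ℕ) →
    ((GP x y ≡ 0) ⇔
      ((x ≡ 0 × y ≡ 0)
       ⊎ (∃[ n ] (n ≥ 1 × x ≡ 2 * n ∸ 1 × y ≡ 2 * n))
       ⊎ (∃[ n ] (n ≥ 1 × x ≡ 2 * n × y ≡ 2 * n ∸ 1))))
    × ((GP x y ≡ 1) ⇔
      ((x ≡ 0 × y ≡ 2) ⊎ (x ≡ 2 × y ≡ 0)
       ⊎ (x ≡ y × ¬ (x ≡ 0) × ¬ (x ≡ 2))))
    × ((GP x y ≡ 2) ⇔
      ((x ≡ 0 × y ≡ 1) ⊎ (x ≡ 1 × y ≡ 0) ⊎ (x ≡ 2 × y ≡ 2)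
       ⊎ (x ≡ 3 × y ≡ 5) ⊎ (x ≡ 4 × y ≡ 7) ⊎ (x ≡ 5 × y ≡ 3)
       ⊎ (x ≡ 6 × y ≡ 8) ⊎ (x ≡ 7 × y ≡ 4) ⊎ (x ≡ 8 × y ≡ 6)
       ⊎ ((x ∸ 1) ⊕ (y ∸ 1) ≡ 3 × x ≥ 9 × y ≥ 9)))
lemma4 x y =
    ⇔-trans (Pass.g≡⇔partner x y (s≤s z≤n)) (pass₀-spec x y)
  , ⇔-trans (Pass.g≡⇔partner x y (s≤s (s≤s z≤n))) (pass₁-spec x y)
  , ⇔-trans (Pass.g≡⇔partner x y (s≤s (s≤s (s≤s z≤n)))) (pass₂-spec x y)
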